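{- Let $G$ be a disconnected finite simple graph that does not contain the co-diamond as an induced subgraph. Then either every connected component of $G$ is a clique, or $G$ is the disjoint union of a complete multipartite graph and a single isolated vertex $K_1$.
   Context: The co-diamond is the four-vertex graph consisting of one edge and two isolated vertices (the complement of $K_4$ minus an edge). -}

module Defs where

open import Data.Nat using (ℕ; suc)
open import Data.Fin using (Fin; zero; suc; punchIn)
open import Data.Bool using (Bool; true; false)
open import Data.Product using (Σ; ∃; _×_; _,_)
open import Relation.Binary.PropositionalEquality using (_≡_; _≢_)
open import Relation.Binary.Construct.Closure.ReflexiveTransitive using (Star)
open import Relation.Nullary using (¬_)
open import Function.Bundles using (_⇔_)
open import Function.Definitions using (Injective)

record SimpleGraph (n : ℕ) : Set where
  field
    adj   : Fin n → Fin n → Bool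
    sym   : ∀ u v → adj u v ≡ adj v u
    loopless : ∀ v → adj v v ≡ false

open SimpleGraph public

Adj : ∀ {n} → SimpleGraph n → Fin n → Fin n → Set
Adj G u v = adj G u v ≡ true

Connected : ∀ {n} → SimpleGraph n → Fin n → Fin n → Set
Connected G = Star (Adj G)

Disconnected : ∀ {n} → SimpleGraph n → Set
Disconnected G = ∃ λ u → ∃ λ v → ¬ Connected G u v

IsInducedSubgraph : ∀ {m n} → SimpleGraph m → SimpleGraph n → Set
IsInducedSubgraph {m} {n} H G =
  Σ (Fin m → Fin n) λ f → Injective _≡_ _≡_ f × (∀ i j → adj G (f i) (f j) ≡ adj H i j)

coDiamondAdj : Fin 4 → Fin 4 → Bool
coDiamondAdj zero (suc zero) = true
coDiamondAdj (suc zero) zero = true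
coDiamondAdj _ _ = false

coDiamond : SimpleGraph 4
coDiamond = record { adj = coDiamondAdj ; sym = s ; loopless = l }
  where
  s : ∀ u v → coDiamondAdj u v ≡ coDiamondAdj v u
  s zero zero = _≡_.refl
  s zero (suc zero) = _≡_.refl
  s zero (suc (suc _)) = _≡_.refl
  s (suc zero) zero = _≡_.refl
  s (suc zero) (suc zero) = _≡_.refl
  s (suc zero) (suc (suc _)) = _≡_.refl
  s (suc (suc _)) zero = _≡_.refl
  s (suc (suc _)) (suc zero) = _≡_.refl
  s (suc (suc _)) (suc (suc _)) = _≡_.refl
  l : ∀ v → coDiamondAdj v v ≡ false
  l zero = _≡_.refl
  l (suc zero) = _≡_.refl
  l (suc (suc _)) = _≡_.refl

CoDiamondFree : ∀ {n} → SimpleGraph n → Set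
CoDiamondFree G = ¬ IsInducedSubgraph coDiamond G

ComponentsAreCliques : ∀ {n} → SimpleGraph n → Set
ComponentsAreCliques G = ∀ u v → Connected G u v → u ≢ v → Adj G u v

IsCompleteMultipartite : ∀ {n} → SimpleGraph n → Set
IsCompleteMultipartite {n} G =
  ∃ λ (k : ℕ) → Σ (Fin n → Fin k) λ part → ∀ u v → Adj G u v ⇔ (part u ≢ part v)

deleteVertex : ∀ {n} → SimpleGraph (suc n) → Fin (suc n) → SimpleGraph n
deleteVertex G w = record
  { adj = λ i j → adj G (punchIn w i) (punchIn w j)
  ; sym = λ i j → sym G (punchIn w i) (punchIn w j)
  ; loopless = λ i → loopless G (punchIn w i) }

IsolatedVertex : ∀ {n} → SimpleGraph n → Fin n → Set
IsolatedVertex G w = ∀ v → ¬ Adj G w v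

IsCompleteMultipartitePlusK1 : ∀ {n} → SimpleGraph n → Set
IsCompleteMultipartitePlusK1 {ℕ.zero} G = Data.Empty.⊥
  where import Data.Empty
IsCompleteMultipartitePlusK1 {suc n} G =
  ∃ λ w → IsolatedVertex G w × IsCompleteMultipartite (deleteVertex G w)

module Submission where

-- Call a pair a, c of distinct, non-adjacent vertices in one
-- component a non-clique pair.  If w lies outside the component of a and w
-- has a neighbour y, then {w, y, a, c} induces a co-diamond (edge w–y, and
-- a, c are isolated from it).  Hence, in a co-diamond-free graph:
--   * if no vertex is isolated, there is no non-clique pair: by
--     disconnectedness some vertex lies outside the component of a, and it
--     would have to be isolated; so every component is a clique;
--   * if w is isolated, then for x ~ y and any third vertex p ≠ w
--     non-adjacent to y, the set {x, y, p, w} would be a co-diamond unless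
--     x ~ p; so non-adjacency is transitive in G - w, and a graph with
--     transitive non-adjacency is complete multipartite (the parts are the
--     non-adjacency classes, labelled by their first member).

open import Defs
open import Data.Nat using (ℕ; suc)
open import Data.Sum using (_⊎_; inj₁; inj₂)
open import Data.Fin using (Fin; zero; suc; punchIn; inject₁)
open import Data.Fin.Properties using (any?; all?; punchInᵢ≢i; inject₁-injective)
open import Data.Bool using (Bool; true; false; _≟_)
open import Data.Bool.Properties using (¬-not)
open import Data.Product using (Σ; _×_; _,_)
open import Data.Empty using (⊥-elim)
open import Relation.Nullary using (¬_; Dec; yes; no; ¬?)
open import Relation.Binary.PropositionalEquality
  using (_≡_; _≢_; refl; cong) renaming (sym to ≡-sym; trans to ≡-trans)
open import Relation.Binary.Construct.Closure.ReflexiveTransitive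
  using (ε; _◅_; _◅◅_; reverse)
open import Function.Bundles using (mk⇔)

-- Non-adjacency is transitive; together with looplessness and symmetry it
-- is then an equivalence relation, whose classes will be the parts.
NonAdjacencyTransitive : ∀ {n} → SimpleGraph n → Set
NonAdjacencyTransitive G =
  ∀ x p y → adj G x p ≡ false → adj G p y ≡ false → adj G x y ≡ false

module _ {n : ℕ} (G : SimpleGraph n) where

  flipAdj : ∀ {u v b} → adj G u v ≡ b → adj G v u ≡ b
  flipAdj {u} {v} e = ≡-trans (sym G v u) e

  identifiedAreTwins : ∀ {m} (H : SimpleGraph m) (f : Fin m → Fin n) →
    (∀ i j → adj G (f i) (f j) ≡ adj H i j) →
    ∀ {i j} → f i ≡ f j → ∀ k → adj H i k ≡ adj H j k
  identifiedAreTwins H f pres {i} {j} fi≡fj k =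
    ≡-trans (≡-sym (pres i k))
      (≡-trans (cong (λ x → adj G x (f k)) fi≡fj) (pres j k))

  -- The other distinctness conditions follow from the edges:
  -- p and q are separated by the loop at p, and r, s from p, q by the edge.
  coDiamondOn : ∀ p q r s → adj G p q ≡ true →
    adj G p r ≡ false → adj G p s ≡ false → adj G q r ≡ false →
    adj G q s ≡ false → adj G r s ≡ false → r ≢ s →
    IsInducedSubgraph coDiamond G
  coDiamondOn p q r s pq pr ps qr qs rs r≢s = f , injective , preserves
    where
    f : Fin 4 → Fin n
    f zero = p
    f (suc zero) = q
    f (suc (suc zero)) = r
    f (suc (suc (suc zero))) = s

    preserves : ∀ i j → adj G (f i) (f j) ≡ coDiamondAdj i j
    preserves zero zero = loopless G p
    preserves zero (suc zero) = pq
    preserves zero (suc (suc zero)) = pr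
    preserves zero (suc (suc (suc zero))) = ps
    preserves (suc zero) zero = flipAdj pq
    preserves (suc zero) (suc zero) = loopless G q
    preserves (suc zero) (suc (suc zero)) = qr
    preserves (suc zero) (suc (suc (suc zero))) = qs
    preserves (suc (suc zero)) zero = flipAdj pr
    preserves (suc (suc zero)) (suc zero) = flipAdj qr
    preserves (suc (suc zero)) (suc (suc zero)) = loopless G r
    preserves (suc (suc zero)) (suc (suc (suc zero))) = rs
    preserves (suc (suc (suc zero))) zero = flipAdj ps
    preserves (suc (suc (suc zero))) (suc zero) = flipAdj qs
    preserves (suc (suc (suc zero))) (suc (suc zero)) = flipAdj rs
    preserves (suc (suc (suc zero))) (suc (suc (suc zero))) = loopless G s

    separatedBy : ∀ {i j} k → f i ≡ f j → coDiamondAdj i k ≢ coDiamondAdj j k → i ≡ j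
    separatedBy k fi≡fj differ =
      ⊥-elim (differ (identifiedAreTwins coDiamond f preserves fi≡fj k))

    injective : ∀ {i j} → f i ≡ f j → i ≡ j
    injective {zero} {zero} _ = refl
    injective {zero} {suc zero} e = separatedBy zero e λ ()
    injective {zero} {suc (suc zero)} e = separatedBy (suc zero) e λ ()
    injective {zero} {suc (suc (suc zero))} e = separatedBy (suc zero) e λ ()
    injective {suc zero} {zero} e = separatedBy zero e λ ()
    injective {suc zero} {suc zero} _ = refl
    injective {suc zero} {suc (suc zero)} e = separatedBy zero e λ ()
    injective {suc zero} {suc (suc (suc zero))} e = separatedBy zero e λ ()
    injective {suc (suc zero)} {zero} e = separatedBy (suc zero) e λ ()
    injective {suc (suc zero)} {suc zero} e = separatedBy zero e λ ()
    injective {suc (suc zero)} {suc (suc zero)} _ = refl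
    injective {suc (suc zero)} {suc (suc (suc zero))} e = ⊥-elim (r≢s e)
    injective {suc (suc (suc zero))} {zero} e = separatedBy (suc zero) e λ ()
    injective {suc (suc (suc zero))} {suc zero} e = separatedBy zero e λ ()
    injective {suc (suc (suc zero))} {suc (suc zero)} e = ⊥-elim (r≢s (≡-sym e))
    injective {suc (suc (suc zero))} {suc (suc (suc zero))} _ = refl

  outsideNonAdjacent : ∀ {a t z} → Connected G a t → ¬ Connected G a z →
    adj G z t ≡ false
  outsideNonAdjacent a⇝t a⇸z = ¬-not λ z~t → a⇸z (a⇝t ◅◅ (flipAdj z~t ◅ ε))

  -- Key lemma: if the component of a contains a non-clique pair a, c, then
  -- every vertex w outside it is isolated; a neighbour y of w would give
  -- the induced co-diamond w–y, a, c.
  outsideNonCliqueIsolated : CoDiamondFree G → ∀ a c w →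
    Connected G a c → adj G a c ≡ false → a ≢ c → ¬ Connected G a w →
    IsolatedVertex G w
  outsideNonCliqueIsolated noCoDiamond a c w a⇝c a≁c a≢c a⇸w y w~y =
    noCoDiamond (coDiamondOn w y a c w~y
      (outsideNonAdjacent ε a⇸w) (outsideNonAdjacent a⇝c a⇸w)
      (outsideNonAdjacent ε a⇸y) (outsideNonAdjacent a⇝c a⇸y) a≁c a≢c)
    where
    a⇸y : ¬ Connected G a y
    a⇸y a⇝y = a⇸w (a⇝y ◅◅ (flipAdj w~y ◅ ε))

  -- Without isolated vertices, a disconnected co-diamond-free graph has no
  -- non-clique pair: of two vertices u, v in different components, one lies
  -- outside the component of the pair and would be isolated.
  componentsAreCliques : Disconnected G → CoDiamondFree G →
    (∀ w → ¬ IsolatedVertex G w) → ComponentsAreCliques G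
  componentsAreCliques (u , v , u⇸v) noCoDiamond noIsolated x y x⇝y x≢y =
    ¬-not λ x≁y →
      let isolatedIfOutside w x⇸w =
            outsideNonCliqueIsolated noCoDiamond x y w x⇝y x≁y x≢y x⇸w
      in noIsolated u (isolatedIfOutside u λ x⇝u →
           noIsolated v (isolatedIfOutside v λ x⇝v →
             u⇸v (reverse flipAdj x⇝u ◅◅ x⇝v)))

firstFalse : ∀ {n} → (Fin n → Bool) → Fin (suc n)
firstFalse {ℕ.zero} f = zero
firstFalse {suc n} f with f zero
... | false = zero
... | true = suc (firstFalse (λ j → f (suc j)))

firstFalse-false : ∀ {n} (f : Fin n → Bool) j → f j ≡ false →
  Σ (Fin n) λ i → firstFalse f ≡ inject₁ i × f i ≡ false
firstFalse-false {suc n} f j fj with f zero in f0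
... | false = zero , refl , f0
firstFalse-false {suc n} f zero fj | true with () ← ≡-trans (≡-sym fj) f0
firstFalse-false {suc n} f (suc j) fj | true
  with firstFalse-false (λ k → f (suc k)) j fj
... | i , found , fi = suc i , cong suc found , fi

firstFalse-cong : ∀ {n} (f g : Fin n → Bool) → (∀ j → f j ≡ g j) →
  firstFalse f ≡ firstFalse g
firstFalse-cong {ℕ.zero} f g f≗g = refl
firstFalse-cong {suc n} f g f≗g with f zero | g zero | f≗g zero
... | false | false | _ = refl
... | true | true | _ =
  cong suc (firstFalse-cong (λ j → f (suc j)) (λ j → g (suc j)) (λ j → f≗g (suc j)))

sameFalsity : ∀ {a b : Bool} → (a ≡ false → b ≡ false) → (b ≡ false → a ≡ false) → a ≡ b
sameFalsity {false} {false} _ _ = refl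
sameFalsity {false} {true} a⇒b _ = ≡-sym (a⇒b refl)
sameFalsity {true} {false} _ b⇒a = b⇒a refl
sameFalsity {true} {true} _ _ = refl

-- A graph with transitive non-adjacency is complete multipartite: label each
-- vertex by its first non-neighbour (it is its own non-neighbour, so one
-- exists); non-adjacent vertices have the same non-neighbours, while
-- adjacent ones cannot share a non-neighbour.
transitiveNonAdjacency⇒multipartite : ∀ {m} (G : SimpleGraph m) →
  NonAdjacencyTransitive G → IsCompleteMultipartite G
transitiveNonAdjacency⇒multipartite {m} G trans =
  suc m , part , λ x y → mk⇔ (adjacent⇒differentParts x y) (differentParts⇒adjacent x y)
  where
  part : Fin m → Fin (suc m)
  part x = firstFalse (adj G x)

  adjacent⇒differentParts : ∀ x y → Adj G x y → part x ≢ part y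
  adjacent⇒differentParts x y x~y same
    with firstFalse-false (adj G x) x (loopless G x)
       | firstFalse-false (adj G y) y (loopless G y)
  ... | i , part-x , x≁i | j , part-y , y≁j
    with refl ← inject₁-injective (≡-trans (≡-sym part-x) (≡-trans same part-y))
    with () ← ≡-trans (≡-sym x~y) (trans x i y x≁i (flipAdj G y≁j))

  differentParts⇒adjacent : ∀ x y → part x ≢ part y → Adj G x y
  differentParts⇒adjacent x y different = ¬-not λ x≁y →
    different (firstFalse-cong (adj G x) (adj G y) λ j →
      sameFalsity (trans y x j (flipAdj G x≁y)) (trans x y j x≁y))

-- In a co-diamond-free graph with an isolated vertex w, non-adjacency is
-- transitive in G - w: if x ~ y but p ≁ x and p ≁ y, then x, y, p, w
-- would induce a co-diamond.
isolatedVertex⇒transitiveNonAdjacency : ∀ {m} (G : SimpleGraph (suc m)) w →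
  CoDiamondFree G → IsolatedVertex G w → NonAdjacencyTransitive (deleteVertex G w)
isolatedVertex⇒transitiveNonAdjacency G w noCoDiamond isolated x p y x≁p p≁y =
  ¬-not λ x~y → noCoDiamond (coDiamondOn G (punchIn w x) (punchIn w y) (punchIn w p) w
    x~y x≁p (toW x) (flipAdj G p≁y) (toW y) (toW p) (punchInᵢ≢i w p))
  where
  toW : ∀ v → adj G (punchIn w v) w ≡ false
  toW v = flipAdj G (¬-not (isolated (punchIn w v)))

lemma8 : ∀ {n : ℕ} (G : SimpleGraph n) → Disconnected G → CoDiamondFree G →
    ComponentsAreCliques G ⊎ IsCompleteMultipartitePlusK1 G
lemma8 {ℕ.zero} G (() , _)
lemma8 {suc m} G disconnected noCoDiamond with any? isolated?
  where
  isolated? : ∀ w → Dec (IsolatedVertex G w)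
  isolated? w = all? λ v → ¬? (adj G w v ≟ true)
... | yes (w , isolated) =
  inj₂ (w , isolated , transitiveNonAdjacency⇒multipartite (deleteVertex G w)
    (isolatedVertex⇒transitiveNonAdjacency G w noCoDiamond isolated))
... | no noIsolated =
  inj₁ (componentsAreCliques G disconnected noCoDiamond λ w isolated → noIsolated (w , isolated))
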